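{- Let $T$ be a tournament with $|V(T)|\le 3$ and let $ET$ be any extended tournament of $T$. Then $\chi'_{\mathrm{wo}}(ET)\le 2$.
   Context: A tournament is an orientation of a complete graph. Given a tournament $T$ with vertices $v_1,\dots,v_n$ and integers $s_1,\dots,s_n\ge 1$, the extended tournament $ET$ has vertex set $I_1\cup\dots\cup I_n$ (disjoint sets, $|I_i|=s_i$, each $I_i$ independent), and for $x\in I_i$, $y\in I_j$ ($i\ne j$) there is an arc $xy$ iff $v_iv_j\in A(T)$. For a vertex $v$ of a digraph $D$, the semi-cuts of $v$ are $\partial^+(v)$ (arcs leaving $v$) and $\partial^-(v)$ (arcs entering $v$). A map $\varphi:A(D)\to[k]=\{1,\dots,k\}$ satisfies condition (WO) at $v$ if there is a color $i\in[k]$ such that every nonempty semi-cut of $v$ contains an odd number of arcs of color $i$ (vacuous if both semi-cuts are empty). A weak-odd $k$-edge coloring is such a map satisfying (WO) at every vertex, and the weak-odd chromatic index $\chi'_{\mathrm{wo}}(D)$ is the least $k\ge0$ for which one exists. -}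

module Defs where

open import Data.Nat using (ℕ; zero; suc; _+_; _%_; _≤_)
open import Data.Bool using (Bool; true; false; T; if_then_else_)
open import Data.Fin using (Fin; _≟_)
open import Data.List using (List; map; concatMap; allFin)
open import Data.Nat.ListAction using (sum)
open import Data.Product using (Σ; _×_; _,_; ∃-syntax)
open import Data.Sum using (_⊎_)
open import Relation.Nullary using (¬_)
open import Relation.Nullary.Decidable using (⌊_⌋)
open import Relation.Binary.PropositionalEquality using (_≡_; _≢_)

record Tournament (n : ℕ) : Set where
  field
    arc      : Fin n → Fin n → Bool
    irrefl   : ∀ i → arc i i ≡ false
    complete : ∀ i j → i ≢ j →
               (arc i j ≡ true × arc j i ≡ false) ⊎ (arc i j ≡ false × arc j i ≡ true)

-- A finite (simple) digraph given by a vertex type, a duplicate-free list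
-- enumerating all its vertices, and a Boolean arc relation.
record Digraph : Set₁ where
  field
    V     : Set
    verts : List V
    arc   : V → V → Bool

-- Extended tournament ET of T with part sizes s i (≥ 1).
-- Vertex (i , a) is the a-th vertex of I_i; arc (i,a)(j,b) iff v_i v_j ∈ A(T)
-- (irreflexivity of T makes each I_i independent).
ET : ∀ {n} → Tournament n → (Fin n → ℕ) → Digraph
ET {n} t s = record
  { V     = Σ (Fin n) (λ i → Fin (s i))
  ; verts = concatMap (λ i → map (λ a → (i , a)) (allFin (s i))) (allFin n)
  ; arc   = λ x y → Tournament.arc t (Data.Product.proj₁ x) (Data.Product.proj₁ y)
  }

Odd : ℕ → Set
Odd m = m % 2 ≡ 1

Colouring : Digraph → ℕ → Set
Colouring D k = (x y : Digraph.V D) → T (Digraph.arc D x y) → Fin k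

ind : ∀ {k} (c : Fin k) (b : Bool) → (T b → Fin k) → ℕ
ind c false f = 0
ind c true  f = if ⌊ f _ ≟ c ⌋ then 1 else 0

module _ (D : Digraph) where
  open Digraph D

  outDeg inDeg : V → ℕ
  outDeg x = sum (map (λ y → if arc x y then 1 else 0) verts)
  inDeg  x = sum (map (λ y → if arc y x then 1 else 0) verts)

  outCol inCol : ∀ {k} → Colouring D k → Fin k → V → ℕ
  outCol φ c x = sum (map (λ y → ind c (arc x y) (φ x y)) verts)
  inCol  φ c x = sum (map (λ y → ind c (arc y x) (φ y x)) verts)

  WO : ∀ {k} → Colouring D k → V → Set
  WO {k} φ x =
    (outDeg x ≡ 0 × inDeg x ≡ 0)
    ⊎ ∃[ c ] ((¬ outDeg x ≡ 0 → Odd (outCol φ c x)) × (¬ inDeg x ≡ 0 → Odd (inCol φ c x)))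

  WeakOddColouring : ∀ {k} → Colouring D k → Set
  WeakOddColouring φ = ∀ x → WO φ x

  χwo≤ : ℕ → Set
  χwo≤ m = ∃[ k ] (k ≤ m × Σ (Colouring D k) WeakOddColouring)

{-# OPTIONS --safe #-}
-- Call P ⊆ V(T) an odd transversal if it meets every nonempty out- and in-neighbourhood
-- of T in an odd number of vertices. A tournament on at most three vertices has one: on
-- a 3-cycle take all vertices, on a transitive triple all but the middle vertex. Mark one
-- vertex of I_i for each i ∈ P and colour an arc 1 iff exactly one of its ends is marked.
-- At x, the arcs of colour ¬(x marked) are exactly those joining x to marked vertices, so
-- in that colour each nonempty semi-cut of x carries one arc per adjacent part in P: an
-- odd number.
module Submission where

open import Defs
open import Data.Nat as ℕ using (ℕ; zero; suc; _+_; _%_; _≤_; _≥_; s≤s)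
open import Data.Nat.Properties using (≤-refl; +-identityʳ)
open import Data.Nat.ListAction using (sum)
open import Data.Nat.ListAction.Properties using (sum-++)
open import Data.Fin using (Fin; zero; suc; _≟_)
open import Data.Fin.Patterns using (0F; 1F; 2F)
open import Data.Fin.Properties using (all?)
open import Data.Bool as Bool using (Bool; true; false; not; _∧_; _xor_)
open import Data.Bool.Properties using (∧-zeroʳ; xor-comm)
open import Data.List using (List; []; _∷_; _++_; map; concatMap; allFin)
open import Data.List.Properties using (map-cong; map-∘; map-++; map-tabulate)
open import Data.Product using (_×_; _,_; proj₁; proj₂; ∃-syntax)
open import Data.Sum as Sum using (_⊎_; inj₁; inj₂)
open import Data.Empty using (⊥-elim)
open import Function using (_∘_; id)
open import Relation.Nullary using (Dec; ¬_)
open import Relation.Nullary.Decidable using (⌊_⌋; True; toWitness; _⊎-dec_; _×-dec_)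
open import Relation.Binary.PropositionalEquality

indicator : Bool → ℕ
indicator true  = 1
indicator false = 0

bit : Bool → Fin 2
bit false = 0F
bit true  = 1F

isZero : ∀ {m} → Fin m → Bool
isZero zero    = true
isZero (suc _) = false

sum-cong : ∀ {A : Set} {f g : A → ℕ} → f ≗ g → ∀ xs → sum (map f xs) ≡ sum (map g xs)
sum-cong f≗g xs = cong sum (map-cong f≗g xs)

sum-map-zero : ∀ {A : Set} {f : A → ℕ} → (∀ x → f x ≡ 0) → ∀ xs → sum (map f xs) ≡ 0
sum-map-zero f≡0 []       = refl
sum-map-zero f≡0 (x ∷ xs) = cong₂ _+_ (f≡0 x) (sum-map-zero f≡0 xs)

sum-map-concatMap : ∀ {A B : Set} (h : B → ℕ) (f : A → List B) xs →
  sum (map h (concatMap f xs)) ≡ sum (map (λ x → sum (map h (f x))) xs)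
sum-map-concatMap h f []       = refl
sum-map-concatMap h f (x ∷ xs) = begin
  sum (map h (f x ++ concatMap f xs))
    ≡⟨ cong sum (map-++ h (f x) (concatMap f xs)) ⟩
  sum (map h (f x) ++ map h (concatMap f xs))
    ≡⟨ sum-++ (map h (f x)) _ ⟩
  sum (map h (f x)) + sum (map h (concatMap f xs))
    ≡⟨ cong (sum (map h (f x)) +_) (sum-map-concatMap h f xs) ⟩
  sum (map h (f x)) + sum (map (λ x → sum (map h (f x))) xs)
    ∎
  where open ≡-Reasoning

sum-map-allFin-suc : ∀ {m} (f : Fin (suc m) → ℕ) →
  sum (map f (allFin (suc m))) ≡ f zero + sum (map (f ∘ suc) (allFin m))
sum-map-allFin-suc f =
  cong (λ xs → f zero + sum xs) (trans (map-tabulate suc f) (sym (map-tabulate id (f ∘ suc))))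

count : ∀ {n} → (Fin n → Bool) → ℕ
count {n} p = sum (map (indicator ∘ p) (allFin n))

count-cong : ∀ {n} {p q : Fin n → Bool} → p ≗ q → count p ≡ count q
count-cong {n} p≗q = sum-cong (cong indicator ∘ p≗q) (allFin n)

sum-allFin-isZero : ∀ {m} → 1 ≤ m → ∀ u v →
  sum (map (λ b → indicator (u ∧ (isZero b ∧ v))) (allFin m)) ≡ indicator (u ∧ v)
sum-allFin-isZero {suc m} _ u v = begin
  sum (map (λ b → indicator (u ∧ (isZero b ∧ v))) (allFin (suc m)))
    ≡⟨ sum-map-allFin-suc {m} (λ b → indicator (u ∧ (isZero b ∧ v))) ⟩
  indicator (u ∧ v) + sum (map (λ b → indicator (u ∧ false)) (allFin m))
    ≡⟨ cong (indicator (u ∧ v) +_) (sum-map-zero (λ _ → cong indicator (∧-zeroʳ u)) (allFin m)) ⟩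
  indicator (u ∧ v) + 0
    ≡⟨ +-identityʳ _ ⟩
  indicator (u ∧ v)
    ∎
  where open ≡-Reasoning

ind-xor : ∀ b u v → ind (bit (not u)) b (λ _ → bit (u xor v)) ≡ indicator (b ∧ v)
ind-xor false u     v     = refl
ind-xor true  false false = refl
ind-xor true  false true  = refl
ind-xor true  true  false = refl
ind-xor true  true  true  = refl

module _ (D : Digraph) where
  open Digraph D

  xorColouring : (V → Bool) → Colouring D 2
  xorColouring m x y _ = bit (m x xor m y)

  outCol-xorColouring : ∀ m x →
    outCol D (xorColouring m) (bit (not (m x))) x ≡ sum (map (λ y → indicator (arc x y ∧ m y)) verts)
  outCol-xorColouring m x = sum-cong (λ y → ind-xor (arc x y) (m x) (m y)) verts

  inCol-xorColouring : ∀ m x →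
    inCol D (xorColouring m) (bit (not (m x))) x ≡ sum (map (λ y → indicator (arc y x ∧ m y)) verts)
  inCol-xorColouring m x = sum-cong (λ y → trans
    (cong (λ c → ind (bit (not (m x))) (arc y x) (λ _ → bit c)) (xor-comm (m y) (m x)))
    (ind-xor (arc y x) (m x) (m y))) verts

  outDeg≡0 : ∀ {x} → (∀ y → arc x y ≡ false) → outDeg D x ≡ 0
  outDeg≡0 none = sum-map-zero (λ y → cong (Bool.if_then 1 else 0) (none y)) verts

  inDeg≡0 : ∀ {x} → (∀ y → arc y x ≡ false) → inDeg D x ≡ 0
  inDeg≡0 none = sum-map-zero (λ y → cong (Bool.if_then 1 else 0) (none y)) verts

  WO-intro : ∀ {k} (φ : Colouring D k) x c →
    (∀ y → arc x y ≡ false) ⊎ Odd (outCol D φ c x) →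
    (∀ y → arc y x ≡ false) ⊎ Odd (inCol D φ c x) →
    WO D φ x
  WO-intro φ x c out in′ = inj₂ (c , outOdd out , inOdd in′)
    where
    outOdd : (∀ y → arc x y ≡ false) ⊎ Odd (outCol D φ c x) → ¬ outDeg D x ≡ 0 → Odd (outCol D φ c x)
    outOdd (inj₁ none) nonzero = ⊥-elim (nonzero (outDeg≡0 none))
    outOdd (inj₂ odd)  _       = odd
    inOdd : (∀ y → arc y x ≡ false) ⊎ Odd (inCol D φ c x) → ¬ inDeg D x ≡ 0 → Odd (inCol D φ c x)
    inOdd (inj₁ none) nonzero = ⊥-elim (nonzero (inDeg≡0 none))
    inOdd (inj₂ odd)  _       = odd

OddMeets : ∀ {n} → (Fin n → Bool) → (Fin n → Bool) → Set
OddMeets P N = (∀ j → N j ≡ false) ⊎ Odd (count (λ j → N j ∧ P j))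

OddTransversal : ∀ {n} → (Fin n → Fin n → Bool) → (Fin n → Bool) → Set
OddTransversal A P = ∀ i → OddMeets P (A i) × OddMeets P (λ j → A j i)

module _ {n} (t : Tournament n) (s : Fin n → ℕ) where
  open Tournament t

  private
    G : Digraph
    G = ET t s

  open Digraph G using (V; verts)

  sum-verts : (h : V → ℕ) →
    sum (map h verts) ≡ sum (map (λ j → sum (map (λ b → h (j , b)) (allFin (s j)))) (allFin n))
  sum-verts h = trans (sum-map-concatMap h _ (allFin n))
    (sum-cong (λ j → cong sum (sym (map-∘ (allFin (s j))))) (allFin n))

  marked : (Fin n → Bool) → V → Bool
  marked P (i , a) = isZero a ∧ P i

  module _ (s≥1 : ∀ i → s i ≥ 1) (P : Fin n → Bool) where

    sum-marked : (N : Fin n → Bool) →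
      sum (map (λ y → indicator (N (proj₁ y) ∧ marked P y)) verts) ≡ count (λ j → N j ∧ P j)
    sum-marked N = trans (sum-verts _) (sum-cong (λ j → sum-allFin-isZero (s≥1 j) (N j) (P j)) (allFin n))

    xorColouring-marked-weakOdd : OddTransversal arc P → WeakOddColouring G (xorColouring G (marked P))
    xorColouring-marked-weakOdd odd x@(i , a) = WO-intro G φ x c
      (Sum.map (λ none y → none (proj₁ y)) (subst Odd (sym outCol≡)) (proj₁ (odd i)))
      (Sum.map (λ none y → none (proj₁ y)) (subst Odd (sym inCol≡)) (proj₂ (odd i)))
      where
      φ : Colouring G 2
      φ = xorColouring G (marked P)
      c : Fin 2
      c = bit (not (marked P x))
      outCol≡ : outCol G φ c x ≡ count (λ j → arc i j ∧ P j)
      outCol≡ = trans (outCol-xorColouring G (marked P) x) (sum-marked (arc i))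
      inCol≡ : inCol G φ c x ≡ count (λ j → arc j i ∧ P j)
      inCol≡ = trans (inCol-xorColouring G (marked P) x) (sum-marked (λ j → arc j i))

oddMeets? : ∀ {n} (P N : Fin n → Bool) → Dec (OddMeets P N)
oddMeets? P N = all? (λ j → N j Bool.≟ false) ⊎-dec (count (λ j → N j ∧ P j) % 2 ℕ.≟ 1)

oddTransversal? : ∀ {n} (A : Fin n → Fin n → Bool) (P : Fin n → Bool) → Dec (OddTransversal A P)
oddTransversal? A P = all? (λ i → oddMeets? P (A i) ×-dec oddMeets? P (λ j → A j i))

oddTransversal-by-decision : ∀ {n} (A : Fin n → Fin n → Bool) (P : Fin n → Bool) →
  {True (oddTransversal? A P)} → ∃[ P ] OddTransversal A P
oddTransversal-by-decision A P {ok} = P , toWitness ok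

OddMeets-resp : ∀ {n} {P N M : Fin n → Bool} → N ≗ M → OddMeets P M → OddMeets P N
OddMeets-resp N≗M (inj₁ none) = inj₁ (λ j → trans (N≗M j) (none j))
OddMeets-resp {P = P} N≗M (inj₂ odd) =
  inj₂ (subst Odd (count-cong (λ j → cong (_∧ P j) (sym (N≗M j)))) odd)

OddTransversal-resp : ∀ {n} {A B : Fin n → Fin n → Bool} {P} → (∀ i j → A i j ≡ B i j) →
  OddTransversal B P → OddTransversal A P
OddTransversal-resp A≡B odd i =
  OddMeets-resp (A≡B i) (proj₁ (odd i)) , OddMeets-resp (λ j → A≡B j i) (proj₂ (odd i))

arc-converse : ∀ {n} (t : Tournament n) {i j} → i ≢ j → Tournament.arc t j i ≡ not (Tournament.arc t i j)
arc-converse t {i} {j} i≢j with Tournament.complete t i j i≢j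
... | inj₁ (ij , ji) rewrite ij | ji = refl
... | inj₂ (ij , ji) rewrite ij | ji = refl

tournament₂ : Bool → Fin 2 → Fin 2 → Bool
tournament₂ a 0F 0F = false
tournament₂ a 0F 1F = a
tournament₂ a 1F 0F = not a
tournament₂ a 1F 1F = false

tournament₃ : Bool → Bool → Bool → Fin 3 → Fin 3 → Bool
tournament₃ a b c 0F 0F = false
tournament₃ a b c 0F 1F = a
tournament₃ a b c 0F 2F = b
tournament₃ a b c 1F 0F = not a
tournament₃ a b c 1F 1F = false
tournament₃ a b c 1F 2F = c
tournament₃ a b c 2F 0F = not b
tournament₃ a b c 2F 1F = not c
tournament₃ a b c 2F 2F = false

module _ (t : Tournament 2) where
  open Tournament t

  arc≡tournament₂ : ∀ i j → arc i j ≡ tournament₂ (arc 0F 1F) i j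
  arc≡tournament₂ 0F 0F = irrefl 0F
  arc≡tournament₂ 0F 1F = refl
  arc≡tournament₂ 1F 0F = arc-converse t (λ ())
  arc≡tournament₂ 1F 1F = irrefl 1F

module _ (t : Tournament 3) where
  open Tournament t

  arc≡tournament₃ : ∀ i j → arc i j ≡ tournament₃ (arc 0F 1F) (arc 0F 2F) (arc 1F 2F) i j
  arc≡tournament₃ 0F 0F = irrefl 0F
  arc≡tournament₃ 0F 1F = refl
  arc≡tournament₃ 0F 2F = refl
  arc≡tournament₃ 1F 0F = arc-converse t (λ ())
  arc≡tournament₃ 1F 1F = irrefl 1F
  arc≡tournament₃ 1F 2F = refl
  arc≡tournament₃ 2F 0F = arc-converse t (λ ())
  arc≡tournament₃ 2F 1F = arc-converse t (λ ())
  arc≡tournament₃ 2F 2F = irrefl 2F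

full : ∀ {n} → Fin n → Bool
full _ = true

allBut : ∀ {n} → Fin n → Fin n → Bool
allBut k i = not ⌊ i ≟ k ⌋

tournament₂-oddTransversal : ∀ a → ∃[ P ] OddTransversal (tournament₂ a) P
tournament₂-oddTransversal false = oddTransversal-by-decision _ full
tournament₂-oddTransversal true  = oddTransversal-by-decision _ full

tournament₃-oddTransversal : ∀ a b c → ∃[ P ] OddTransversal (tournament₃ a b c) P
tournament₃-oddTransversal true  false true  = oddTransversal-by-decision _ full
tournament₃-oddTransversal false true  false = oddTransversal-by-decision _ full
tournament₃-oddTransversal true  true  true  = oddTransversal-by-decision _ (allBut 1F)
tournament₃-oddTransversal true  true  false = oddTransversal-by-decision _ (allBut 2F)
tournament₃-oddTransversal true  false false = oddTransversal-by-decision _ (allBut 0F)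
tournament₃-oddTransversal false true  true  = oddTransversal-by-decision _ (allBut 0F)
tournament₃-oddTransversal false false true  = oddTransversal-by-decision _ (allBut 2F)
tournament₃-oddTransversal false false false = oddTransversal-by-decision _ (allBut 1F)

tournament-oddTransversal : ∀ {n} → n ≤ 3 → (t : Tournament n) → ∃[ P ] OddTransversal (Tournament.arc t) P
tournament-oddTransversal {0} _ t = full , λ ()
tournament-oddTransversal {1} _ t = full , λ { 0F → inj₁ (loopless 0F) , inj₁ (λ j → loopless j 0F) }
  where
  loopless : ∀ i j → Tournament.arc t i j ≡ false
  loopless 0F 0F = Tournament.irrefl t 0F
tournament-oddTransversal {2} _ t =
  let P , odd = tournament₂-oddTransversal (arc 0F 1F)
  in P , OddTransversal-resp {P = P} (arc≡tournament₂ t) odd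
  where open Tournament t
tournament-oddTransversal {3} _ t =
  let P , odd = tournament₃-oddTransversal (arc 0F 1F) (arc 0F 2F) (arc 1F 2F)
  in P , OddTransversal-resp {P = P} (arc≡tournament₃ t) odd
  where open Tournament t
tournament-oddTransversal {suc (suc (suc (suc _)))} (s≤s (s≤s (s≤s ()))) t

theorem4p3 : (n : ℕ) → n ≤ 3 → (t : Tournament n) → (s : Fin n → ℕ) → (∀ i → s i ≥ 1) →
    χwo≤ (ET t s) 2
theorem4p3 n n≤3 t s s≥1 =
  let P , odd = tournament-oddTransversal n≤3 t
  in 2 , ≤-refl , xorColouring (ET t s) (marked t s P) , xorColouring-marked-weakOdd t s s≥1 P odd
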